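{- For any graph $G$, $\mathrm{modpw}(G)\le\max(2,\mathrm{tcpw}(G))$ and $\mathrm{modtw}(G)\le\max(2,\mathrm{tctw}(G))$.
   Context: Twins: $u,v$ are twins if $N(u)\setminus\{v\}=N(v)\setminus\{u\}$; $\Pi_{tc}(G)$ is the partition into twinclasses (equivalence classes). For a partition $\Pi$ of $V$, the quotient graph $G/\Pi$ has vertex set $\Pi$ and an edge between distinct parts iff some edge of $G$ joins them. $\mathrm{tcpw}(G)=\mathrm{pw}(G/\Pi_{tc}(G))$, $\mathrm{tctw}(G)=\mathrm{tw}(G/\Pi_{tc}(G))$. Modular decomposition: a module is $M\subseteq V$ with $N(v)\setminus M=N(w)\setminus M$ for all $v,w\in M$; strong if it does not overlap any module. Nonempty strong modules form the modular decomposition tree. For a graph with at least two vertices, $\Pi_{mod}(G)$ is the partition of $V$ into inclusion-maximal strong modules different from $V$. For each non-singleton strong module $M$, the quotient graph at $M$ is $G[M]/\Pi_{mod}(G[M])$, which is edgeless, complete or prime (only trivial modules). $\mathcal{H}_p(G)$ is the set of prime ones; $\mathrm{modpw}(G)=\max(2,\max_{H\in\mathcal{H}_p(G)}\mathrm{pw}(H))$ and $\mathrm{modtw}(G)=\max(2,\max_{H\in\mathcal{H}_p(G)}\mathrm{tw}(H))$. -}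

module Defs where

open import Data.Nat using (ℕ; zero; suc; _≤_; _⊔_)
open import Data.Fin using (Fin; toℕ) renaming (zero to fzero; suc to fsuc)
open import Data.Fin.Subset using (Subset; _∈_; _∉_; _⊆_; ∣_∣; ⁅_⁆; Nonempty) renaming (⊥ to ∅; ⊤ to Full)
open import Data.Product using (Σ; ∃; ∃-syntax; _×_; _,_; proj₁; proj₂)
open import Data.Sum using (_⊎_)
open import Relation.Nullary using (¬_)
open import Relation.Binary.PropositionalEquality using (_≡_; _≢_; refl; sym)
open import Function.Definitions using (Injective)

record Graph (n : ℕ) : Set₁ where
  field
    E      : Fin n → Fin n → Set
    E-sym  : ∀ {u v} → E u v → E v u
    E-irr  : ∀ {v} → ¬ E v v
open Graph public

_⇔′_ : Set → Set → Set
A ⇔′ B = (A → B) × (B → A)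

Twins : ∀ {n} → Graph n → Fin n → Fin n → Set
Twins G u v = ∀ x → x ≢ u → x ≢ v → (E G u x ⇔′ E G v x)

-- A partition of Fin n into t parts, given by a surjective labelling map.
-- q is a twinclass map: parts are exactly the twin classes.
IsTwinClassMap : ∀ {n t} → Graph n → (Fin n → Fin t) → Set
IsTwinClassMap G q =
  (∀ i → ∃[ u ] q u ≡ i) × (∀ u v → (q u ≡ q v) ⇔′ Twins G u v)

Quot : ∀ {n m} → Graph n → (Fin n → Fin m) → Graph m
Quot {n} {m} G p = record { E = E′ ; E-sym = sy ; E-irr = ir }
  where
  E′ : Fin m → Fin m → Set
  E′ i j = i ≢ j × ∃[ u ] ∃[ v ] (p u ≡ i × p v ≡ j × E G u v)
  sy : ∀ {i j} → E′ i j → E′ j i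
  sy (ne , u , v , pu , pv , e) = (λ eq → ne (sym eq)) , v , u , pv , pu , E-sym G e
  ir : ∀ {i} → ¬ E′ i i
  ir (ne , _) = ne refl

-- Modules, relative to an ambient vertex set S (so that "module of G[S]"
-- is IsModuleIn G S X, and "module of G" is IsModuleIn G Full X).

IsModuleIn : ∀ {n} → Graph n → Subset n → Subset n → Set
IsModuleIn G S X =
  X ⊆ S × (∀ v w x → v ∈ X → w ∈ X → x ∈ S → x ∉ X → (E G v x ⇔′ E G w x))

Overlap : ∀ {n} → Subset n → Subset n → Set
Overlap X Y = (∃[ x ] (x ∈ X × x ∈ Y)) × ¬ (X ⊆ Y) × ¬ (Y ⊆ X)

IsStrongIn : ∀ {n} → Graph n → Subset n → Subset n → Set
IsStrongIn G S X = IsModuleIn G S X × (∀ Y → IsModuleIn G S Y → ¬ Overlap X Y)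

IsModPart : ∀ {n} → Graph n → Subset n → Subset n → Set
IsModPart G M X =
  IsStrongIn G M X × Nonempty X × X ≢ M ×
  (∀ Y → IsStrongIn G M Y → Nonempty Y → Y ≢ M → X ⊆ Y → Y ⊆ X)

IsNonSingletonStrong : ∀ {n} → Graph n → Subset n → Set
IsNonSingletonStrong G M =
  IsStrongIn G Full M × ∃[ x ] ∃[ y ] (x ∈ M × y ∈ M × x ≢ y)

IsModPartition : ∀ {n m} → Graph n → Subset n → (Fin m → Subset n) → Set
IsModPartition G M f =
  Injective _≡_ _≡_ f × (∀ i → IsModPart G M (f i)) ×
  (∀ X → IsModPart G M X → ∃[ i ] f i ≡ X)

-- The quotient graph at M, G[M]/Π_mod(G[M]), with parts enumerated by f.
QuotAt : ∀ {n m} → Graph n → (Fin m → Subset n) → Graph m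
QuotAt {n} {m} G f = record { E = E′ ; E-sym = sy ; E-irr = ir }
  where
  E′ : Fin m → Fin m → Set
  E′ i j = i ≢ j × ∃[ u ] ∃[ v ] (u ∈ f i × v ∈ f j × E G u v)
  sy : ∀ {i j} → E′ i j → E′ j i
  sy (ne , u , v , pu , pv , e) = (λ eq → ne (sym eq)) , v , u , pv , pu , E-sym G e
  ir : ∀ {i} → ¬ E′ i i
  ir (ne , _) = ne refl

IsPrime : ∀ {m} → Graph m → Set
IsPrime {m} H = ∀ X → IsModuleIn H Full X → X ≡ ∅ ⊎ (∃[ i ] X ≡ ⁅ i ⁆) ⊎ X ≡ Full

InHp : ∀ {n m} → Graph n → (Fin m → Subset n) → Set
InHp G f = ∃[ M ] (IsNonSingletonStrong G M × IsModPartition G M f) × IsPrime (QuotAt G f)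

record PathDecomposition {n} (G : Graph n) (k : ℕ) : Set where
  field
    len      : ℕ
    bag      : Fin len → Subset n
    covers   : ∀ v → ∃[ i ] v ∈ bag i
    edges    : ∀ u v → E G u v → ∃[ i ] (u ∈ bag i × v ∈ bag i)
    interval : ∀ v (i j l : Fin len) → toℕ i ≤ toℕ j → toℕ j ≤ toℕ l →
               v ∈ bag i → v ∈ bag l → v ∈ bag j
    width    : ∀ i → ∣ bag i ∣ ≤ suc k

PW≤ : ∀ {n} → Graph n → ℕ → Set
PW≤ G k = PathDecomposition G k

-- Trees and tree decompositions (tw(G) ≤ k).
-- A tree on nodes Fin (suc L): node fsuc i has a parent par i whose index
-- is at most i (every finite tree admits such a labelling).

TreeEdge : ∀ {L} → (Fin L → Fin (suc L)) → Fin (suc L) → Fin (suc L) → Set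
TreeEdge par a b = (∃[ i ] (a ≡ fsuc i × b ≡ par i)) ⊎ (∃[ i ] (b ≡ fsuc i × a ≡ par i))

data Reach {L} (par : Fin L → Fin (suc L)) (X : Fin (suc L) → Set) :
           Fin (suc L) → Fin (suc L) → Set where
  here : ∀ {a} → X a → Reach par X a a
  step : ∀ {a b c} → X a → TreeEdge par a b → Reach par X b c → Reach par X a c

record TreeDecomposition {n} (G : Graph n) (k : ℕ) : Set where
  field
    L         : ℕ
    par       : Fin L → Fin (suc L)
    par<      : ∀ i → toℕ (par i) ≤ toℕ i
    bag       : Fin (suc L) → Subset n
    covers    : ∀ v → ∃[ a ] v ∈ bag a
    edges     : ∀ u v → E G u v → ∃[ a ] (u ∈ bag a × v ∈ bag a)
    connected : ∀ v a b → v ∈ bag a → v ∈ bag b → Reach par (λ c → v ∈ bag c) a b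
    width     : ∀ a → ∣ bag a ∣ ≤ suc k

TW≤ : ∀ {n} → Graph n → ℕ → Set
TW≤ G k = TreeDecomposition G k

-- A prime quotient H = G[M]/Π_mod(G[M]) with at least three vertices is an
-- induced subgraph of G (pick one vertex per part), and in a prime graph with
-- at least three vertices no two vertices are twins, since a twin pair would be
-- a nontrivial module. Hence the chosen representatives lie in pairwise
-- distinct twin classes, so H is a subgraph of G/Π_tc(G), and path and tree
-- decompositions of G/Π_tc(G) restrict to H. Quotients with at most two
-- vertices have width at most 2 anyway.
module Submission where

open import Defs
open import Data.Nat using (ℕ; zero; suc; _≤_; _⊔_; z≤n; s≤s)
open import Data.Nat.Properties using (≤-trans; m≤m⊔n; m≤n⊔m)
open import Data.Fin using (Fin) renaming (zero to fzero; suc to fsuc)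
open import Data.Fin.Properties using (suc-injective; 0≢1+n)
open import Data.Fin.Subset using (Subset; inside; outside; _∈_; _∉_; _⊆_; ∣_∣; ⁅_⁆; _∪_; _-_) renaming (⊤ to Full)
open import Data.Fin.Subset.Properties using (_⊆?_; ⊆-antisym; x∈⁅x⁆; x∈⁅y⁆⇒x≡y; x∈p∪q⁺; x∈p∪q⁻; ∈⊤; ∉⊥; ∣p∣≤n; x∈p∧x∉q⇒x∈p─q; x∈p⇒∣p-x∣<∣p∣)
open import Data.Vec using ([]; _∷_; lookup; tabulate)
open import Data.Vec.Properties using ([]=⇒lookup; lookup⇒[]=; lookup∘tabulate)
open import Data.Vec.Base using (here; there)
open import Data.Product using (_×_; _,_; proj₁; proj₂; ∃-syntax)
open import Data.Sum using (_⊎_; inj₁; inj₂)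
open import Data.Empty using (⊥-elim)
open import Relation.Nullary using (yes; no)
open import Relation.Binary.PropositionalEquality using (_≡_; _≢_; refl; sym; trans; subst)
open import Function using (_∘_)
open import Function.Definitions using (Injective)

preimage : ∀ {m t} → (Fin m → Fin t) → Subset t → Subset m
preimage g B = tabulate (lookup B ∘ g)

∈-preimage⁺ : ∀ {m t} (g : Fin m → Fin t) {B a} → g a ∈ B → a ∈ preimage g B
∈-preimage⁺ g {B} {a} ga∈B =
  lookup⇒[]= a _ (trans (lookup∘tabulate (lookup B ∘ g) a) ([]=⇒lookup ga∈B))

∈-preimage⁻ : ∀ {m t} (g : Fin m → Fin t) {B a} → a ∈ preimage g B → g a ∈ B
∈-preimage⁻ g {B} {a} a∈g⁻B =
  lookup⇒[]= (g a) B (trans (sym (lookup∘tabulate (lookup B ∘ g) a)) ([]=⇒lookup a∈g⁻B))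

∣p∣≤∣q∣-by-injection : ∀ {m t} {p : Subset m} {q : Subset t} (g : Fin m → Fin t) →
  Injective _≡_ _≡_ g → (∀ {a} → a ∈ p → g a ∈ q) → ∣ p ∣ ≤ ∣ q ∣
∣p∣≤∣q∣-by-injection {p = []} g g-inj p→q = z≤n
∣p∣≤∣q∣-by-injection {p = outside ∷ p} g g-inj p→q =
  ∣p∣≤∣q∣-by-injection (g ∘ fsuc) (suc-injective ∘ g-inj) (p→q ∘ there)
∣p∣≤∣q∣-by-injection {p = inside ∷ p} {q} g g-inj p→q =
  ≤-trans (s≤s ∣p∣≤∣q-g0∣) (x∈p⇒∣p-x∣<∣p∣ (p→q here))
  where
  ∣p∣≤∣q-g0∣ : ∣ p ∣ ≤ ∣ q - g fzero ∣
  ∣p∣≤∣q-g0∣ = ∣p∣≤∣q∣-by-injection (g ∘ fsuc) (suc-injective ∘ g-inj) λ a∈p →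
    x∈p∧x∉q⇒x∈p─q (p→q (there a∈p)) (λ e → 0≢1+n (sym (g-inj (x∈⁅y⁆⇒x≡y _ e))))

∣preimage∣≤ : ∀ {m t} (g : Fin m → Fin t) → Injective _≡_ _≡_ g → ∀ B → ∣ preimage g B ∣ ≤ ∣ B ∣
∣preimage∣≤ g g-inj B = ∣p∣≤∣q∣-by-injection {q = B} g g-inj (∈-preimage⁻ g)

record InjectiveHom {m t} (H : Graph m) (K : Graph t) : Set where
  field
    map       : Fin m → Fin t
    injective : Injective _≡_ _≡_ map
    preserves : ∀ {a b} → E H a b → E K (map a) (map b)

Reach-map : ∀ {L} {par : Fin L → Fin (suc L)} {X Y : Fin (suc L) → Set} →
  (∀ c → X c → Y c) → ∀ {a b} → Reach par X a b → Reach par Y a b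
Reach-map X⊆Y (here x) = here (X⊆Y _ x)
Reach-map X⊆Y (step x e r) = step (X⊆Y _ x) e (Reach-map X⊆Y r)

module _ {m t} {H : Graph m} {K : Graph t} (h : InjectiveHom H K) {k : ℕ} where
  open InjectiveHom h

  PW≤-injectiveHom : PW≤ K k → PW≤ H k
  PW≤-injectiveHom D = record
    { len      = D.len
    ; bag      = preimage map ∘ D.bag
    ; covers   = λ a → let (l , p) = D.covers (map a) in l , ∈-preimage⁺ map p
    ; edges    = λ a b e → let (l , pa , pb) = D.edges (map a) (map b) (preserves e)
                           in l , ∈-preimage⁺ map pa , ∈-preimage⁺ map pb
    ; interval = λ a i j l i≤j j≤l pi pl → ∈-preimage⁺ map
        (D.interval (map a) i j l i≤j j≤l (∈-preimage⁻ map pi) (∈-preimage⁻ map pl))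
    ; width    = λ l → ≤-trans (∣preimage∣≤ map injective (D.bag l)) (D.width l)
    }
    where module D = PathDecomposition D

  TW≤-injectiveHom : TW≤ K k → TW≤ H k
  TW≤-injectiveHom D = record
    { L         = D.L
    ; par       = D.par
    ; par<      = D.par<
    ; bag       = preimage map ∘ D.bag
    ; covers    = λ a → let (l , p) = D.covers (map a) in l , ∈-preimage⁺ map p
    ; edges     = λ a b e → let (l , pa , pb) = D.edges (map a) (map b) (preserves e)
                            in l , ∈-preimage⁺ map pa , ∈-preimage⁺ map pb
    ; connected = λ a x y px py → Reach-map (λ _ → ∈-preimage⁺ map)
        (D.connected (map a) x y (∈-preimage⁻ map px) (∈-preimage⁻ map py))
    ; width     = λ l → ≤-trans (∣preimage∣≤ map injective (D.bag l)) (D.width l)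
    }
    where module D = TreeDecomposition D

module _ {m} {H : Graph m} {k k′ : ℕ} (k≤k′ : k ≤ k′) where

  PW≤-mono : PW≤ H k → PW≤ H k′
  PW≤-mono D = record { D hiding (width) ; width = λ l → ≤-trans (D.width l) (s≤s k≤k′) }
    where module D = PathDecomposition D

  TW≤-mono : TW≤ H k → TW≤ H k′
  TW≤-mono D = record { D hiding (width) ; width = λ a → ≤-trans (D.width a) (s≤s k≤k′) }
    where module D = TreeDecomposition D

module _ {m} (H : Graph m) {k : ℕ} (m≤1+k : m ≤ suc k) where

  PW≤-small : PW≤ H k
  PW≤-small = record
    { len = 1 ; bag = λ _ → Full ; covers = λ _ → fzero , ∈⊤
    ; edges = λ _ _ _ → fzero , ∈⊤ , ∈⊤ ; interval = λ _ _ _ _ _ _ _ _ → ∈⊤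
    ; width = λ _ → ≤-trans (∣p∣≤n Full) m≤1+k }

  TW≤-small : TW≤ H k
  TW≤-small = record
    { L = 0 ; par = λ () ; par< = λ () ; bag = λ _ → Full ; covers = λ _ → fzero , ∈⊤
    ; edges = λ _ _ _ → fzero , ∈⊤ , ∈⊤ ; connected = connected
    ; width = λ _ → ≤-trans (∣p∣≤n Full) m≤1+k }
    where
    connected : ∀ v (a b : Fin 1) → v ∈ Full → v ∈ Full → Reach (λ ()) (λ c → v ∈ Full) a b
    connected v fzero fzero _ _ = here ∈⊤

strong-comparable : ∀ {n} {G : Graph n} {S X Y : Subset n} {x} →
  IsStrongIn G S X → IsModuleIn G S Y → x ∈ X → x ∈ Y → X ⊆ Y ⊎ Y ⊆ X
strong-comparable {X = X} {Y} X-strong Y-module x∈X x∈Y with X ⊆? Y | Y ⊆? X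
... | yes X⊆Y | _       = inj₁ X⊆Y
... | no _    | yes Y⊆X = inj₂ Y⊆X
... | no X⊈Y  | no Y⊈X  = ⊥-elim (proj₂ X-strong Y Y-module ((_ , x∈X , x∈Y) , X⊈Y , Y⊈X))

module _ {m} {u v : Fin m} where

  ∈-pair⁻ : ∀ {x} → x ∈ ⁅ u ⁆ ∪ ⁅ v ⁆ → x ≡ u ⊎ x ≡ v
  ∈-pair⁻ x∈ with x∈p∪q⁻ ⁅ u ⁆ ⁅ v ⁆ x∈
  ... | inj₁ x∈u = inj₁ (x∈⁅y⁆⇒x≡y u x∈u)
  ... | inj₂ x∈v = inj₂ (x∈⁅y⁆⇒x≡y v x∈v)

  u∈pair : u ∈ ⁅ u ⁆ ∪ ⁅ v ⁆
  u∈pair = x∈p∪q⁺ (inj₁ (x∈⁅x⁆ u))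

  v∈pair : v ∈ ⁅ u ⁆ ∪ ⁅ v ⁆
  v∈pair = x∈p∪q⁺ (inj₂ (x∈⁅x⁆ v))

twins⇒pair-module : ∀ {m} (K : Graph m) {u v} → Twins K u v → IsModuleIn K Full (⁅ u ⁆ ∪ ⁅ v ⁆)
twins⇒pair-module K {u} {v} twins = (λ _ → ∈⊤) , λ a b x a∈ b∈ _ x∉ →
  transfer (∈-pair⁻ a∈) (∈-pair⁻ b∈) (x≢ u∈pair x∉) (x≢ v∈pair x∉) ,
  transfer (∈-pair⁻ b∈) (∈-pair⁻ a∈) (x≢ u∈pair x∉) (x≢ v∈pair x∉)
  where
  x≢ : ∀ {x y} → y ∈ ⁅ u ⁆ ∪ ⁅ v ⁆ → x ∉ ⁅ u ⁆ ∪ ⁅ v ⁆ → x ≢ y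
  x≢ y∈ x∉ refl = x∉ y∈
  transfer : ∀ {a b x} → a ≡ u ⊎ a ≡ v → b ≡ u ⊎ b ≡ v → x ≢ u → x ≢ v → E K a x → E K b x
  transfer (inj₁ refl) (inj₁ refl) _   _   e = e
  transfer (inj₂ refl) (inj₂ refl) _   _   e = e
  transfer (inj₁ refl) (inj₂ refl) x≢u x≢v e = proj₁ (twins _ x≢u x≢v) e
  transfer (inj₂ refl) (inj₁ refl) x≢u x≢v e = proj₂ (twins _ x≢u x≢v) e

∃-≢-both : ∀ {m} (i j : Fin (suc (suc (suc m)))) → ∃[ c ] (c ≢ i × c ≢ j)
∃-≢-both fzero           fzero           = fsuc fzero , (λ ()) , (λ ())
∃-≢-both fzero           (fsuc fzero)    = fsuc (fsuc fzero) , (λ ()) , (λ ())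
∃-≢-both fzero           (fsuc (fsuc _)) = fsuc fzero , (λ ()) , (λ ())
∃-≢-both (fsuc fzero)    fzero           = fsuc (fsuc fzero) , (λ ()) , (λ ())
∃-≢-both (fsuc (fsuc _)) fzero           = fsuc fzero , (λ ()) , (λ ())
∃-≢-both (fsuc _)        (fsuc _)        = fzero , (λ ()) , (λ ())

prime⇒twin-free : ∀ {m} (K : Graph (suc (suc (suc m)))) → IsPrime K →
  ∀ {u v} → Twins K u v → u ≡ v
prime⇒twin-free K prime {u} {v} twins with prime _ (twins⇒pair-module K twins)
... | inj₁ pair≡∅ = ⊥-elim (∉⊥ (subst (u ∈_) pair≡∅ u∈pair))
... | inj₂ (inj₁ (c , pair≡c)) =
  trans (x∈⁅y⁆⇒x≡y c (subst (u ∈_) pair≡c u∈pair)) (sym (x∈⁅y⁆⇒x≡y c (subst (v ∈_) pair≡c v∈pair)))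
... | inj₂ (inj₂ pair≡Full) with ∃-≢-both u v
...   | c , c≢u , c≢v with ∈-pair⁻ (subst (c ∈_) (sym pair≡Full) ∈⊤)
...     | inj₁ c≡u = ⊥-elim (c≢u c≡u)
...     | inj₂ c≡v = ⊥-elim (c≢v c≡v)

module ModPartition {n} (G : Graph n) (M : Subset n) {m} (f : Fin m → Subset n)
                    (f-injective : Injective _≡_ _≡_ f) (f-parts : ∀ i → IsModPart G M (f i)) where

  private
    strong : ∀ i → IsStrongIn G M (f i)
    strong i = proj₁ (f-parts i)

    maximal : ∀ i j → f i ⊆ f j → f j ⊆ f i
    maximal i j = let (_ , _ , _ , max) = f-parts i
                      (sⱼ , neⱼ , ≢Mⱼ , _) = f-parts j
                  in max (f j) sⱼ neⱼ ≢Mⱼ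

  parts-disjoint : ∀ {i j x} → x ∈ f i → x ∈ f j → i ≡ j
  parts-disjoint {i} {j} x∈i x∈j
    with strong-comparable {G = G} {S = M} (strong i) (proj₁ (strong j)) x∈i x∈j
  ... | inj₁ i⊆j = f-injective (⊆-antisym i⊆j (maximal i j i⊆j))
  ... | inj₂ j⊆i = f-injective (⊆-antisym (maximal j i j⊆i) j⊆i)

  rep : Fin m → Fin n
  rep i = proj₁ (proj₁ (proj₂ (f-parts i)))

  rep∈ : ∀ i → rep i ∈ f i
  rep∈ i = proj₂ (proj₁ (proj₂ (f-parts i)))

  rep-injective : Injective _≡_ _≡_ rep
  rep-injective {i} {j} e = parts-disjoint (rep∈ i) (subst (_∈ f j) (sym e) (rep∈ j))

  -- Each part is a module of G[M], so adjacency between two parts is all or nothing.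
  E-QuotAt⇒E : ∀ {i j u v} → E (QuotAt G f) i j → u ∈ f i → v ∈ f j → E G u v
  E-QuotAt⇒E (i≢j , u′ , v′ , u′∈i , v′∈j , e) u∈i v∈j =
    E-sym G (shift (i≢j ∘ sym) v′∈j v∈j u∈i (E-sym G (shift i≢j u′∈i u∈i v′∈j e)))
    where
    shift : ∀ {k l a b c} → k ≢ l → a ∈ f k → b ∈ f k → c ∈ f l → E G a c → E G b c
    shift {k} {l} k≢l a∈k b∈k c∈l =
      proj₁ (proj₂ (proj₁ (strong k)) _ _ _ a∈k b∈k (proj₁ (proj₁ (strong l)) c∈l)
                                       (λ c∈k → k≢l (parts-disjoint c∈k c∈l)))

  twin-reps⇒twins : ∀ {i j} → Twins G (rep i) (rep j) → Twins (QuotAt G f) i j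
  twin-reps⇒twins twins x x≢i x≢j = transfer twins x≢i x≢j , transfer (swap twins) x≢j x≢i
    where
    swap : ∀ {a b} → Twins G a b → Twins G b a
    swap tw y y≢b y≢a = let (to , from) = tw y y≢a y≢b in from , to
    transfer : ∀ {a b} → Twins G (rep a) (rep b) → x ≢ a → x ≢ b → E (QuotAt G f) a x → E (QuotAt G f) b x
    transfer {a} {b} tw x≢a x≢b e =
      (x≢b ∘ sym) , rep b , rep x , rep∈ b , rep∈ x ,
      proj₁ (tw (rep x) (x≢a ∘ rep-injective) (x≢b ∘ rep-injective)) (E-QuotAt⇒E e (rep∈ a) (rep∈ x))

prime-quotient-small-or-embeds : ∀ {n t m} (G : Graph n) (q : Fin n → Fin t) (f : Fin m → Subset n) →
  IsTwinClassMap G q → InHp G f → m ≤ 2 ⊎ InjectiveHom (QuotAt G f) (Quot G q)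
prime-quotient-small-or-embeds {m = zero} _ _ _ _ _ = inj₁ z≤n
prime-quotient-small-or-embeds {m = suc zero} _ _ _ _ _ = inj₁ (s≤s z≤n)
prime-quotient-small-or-embeds {m = suc (suc zero)} _ _ _ _ _ = inj₁ (s≤s (s≤s z≤n))
prime-quotient-small-or-embeds {m = suc (suc (suc _))} G q f
  (_ , q-twins) (M , (_ , f-injective , f-parts , _) , prime) = inj₂ record
  { map       = q ∘ rep
  ; injective = q∘rep-injective
  ; preserves = λ {a} {b} e@(a≢b , _) →
      a≢b ∘ q∘rep-injective , rep a , rep b , refl , refl , E-QuotAt⇒E e (rep∈ a) (rep∈ b)
  }
  where
  open ModPartition G M f f-injective f-parts
  q∘rep-injective : Injective _≡_ _≡_ (q ∘ rep)
  q∘rep-injective {i} {j} e =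
    prime⇒twin-free (QuotAt G f) prime (twin-reps⇒twins {i} {j} (proj₁ (q-twins (rep i) (rep j)) e))

module _ {n t m} (G : Graph n) (q : Fin n → Fin t) (f : Fin m → Subset n)
         (q-twins : IsTwinClassMap G q) (f-prime : InHp G f) {k : ℕ} where

  private
    small⇒≤1+2⊔k : m ≤ 2 → m ≤ suc (2 ⊔ k)
    small⇒≤1+2⊔k m≤2 = ≤-trans m≤2 (s≤s (≤-trans (s≤s z≤n) (m≤m⊔n 2 k)))

  QuotAt-PW≤ : PW≤ (Quot G q) k → PW≤ (QuotAt G f) (2 ⊔ k)
  QuotAt-PW≤ D with prime-quotient-small-or-embeds G q f q-twins f-prime
  ... | inj₁ m≤2 = PW≤-small _ (small⇒≤1+2⊔k m≤2)
  ... | inj₂ h   = PW≤-mono (m≤n⊔m 2 k) (PW≤-injectiveHom h D)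

  QuotAt-TW≤ : TW≤ (Quot G q) k → TW≤ (QuotAt G f) (2 ⊔ k)
  QuotAt-TW≤ D with prime-quotient-small-or-embeds G q f q-twins f-prime
  ... | inj₁ m≤2 = TW≤-small _ (small⇒≤1+2⊔k m≤2)
  ... | inj₂ h   = TW≤-mono (m≤n⊔m 2 k) (TW≤-injectiveHom h D)

lemma3 : ∀ {n} (G : Graph n) →
    (∀ (k : ℕ) {t} (q : Fin n → Fin t) → IsTwinClassMap G q → PW≤ (Quot G q) k →
       ∀ {m} (f : Fin m → Subset n) → InHp G f → PW≤ (QuotAt G f) (2 ⊔ k))
    ×
    (∀ (k : ℕ) {t} (q : Fin n → Fin t) → IsTwinClassMap G q → TW≤ (Quot G q) k →
       ∀ {m} (f : Fin m → Subset n) → InHp G f → TW≤ (QuotAt G f) (2 ⊔ k))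
lemma3 G = (λ k q q-twins D f f-prime → QuotAt-PW≤ G q f q-twins f-prime D)
         , (λ k q q-twins D f f-prime → QuotAt-TW≤ G q f q-twins f-prime D)
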